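{- If a graph $G$ has at most $8$ vertices, then $\iota(G,P_3)\le 2$.
   Context: All graphs are finite and simple. For $D\subseteq V(G)$, $N[D]$ denotes the closed neighbourhood of $D$. A set $D\subseteq V(G)$ is a $P_3$-isolating set of $G$ if $G-N[D]$ contains no copy of the $3$-vertex path $P_3$; $\iota(G,P_3)$ is the minimum size of such a set. -}

module Defs where

open import Data.Nat using (ℕ; _≤_)
open import Data.Fin using (Fin)
open import Data.Bool using (Bool; true; false)
open import Data.List using (List; length)
open import Data.List.Relation.Unary.Any using (Any)
open import Data.Product using (Σ; ∃; _×_; _,_)
open import Data.Sum using (_⊎_)
open import Relation.Binary.PropositionalEquality using (_≡_; _≢_)
open import Relation.Nullary using (¬_)

record Graph (n : ℕ) : Set where
  field
    adj   : Fin n → Fin n → Bool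
    sym   : ∀ u v → adj u v ≡ adj v u
    irrefl : ∀ v → adj v v ≡ false

open Graph public

_∼[_]_ : ∀ {n} → Fin n → Graph n → Fin n → Set
u ∼[ G ] v = adj G u v ≡ true

InClosedNbhd : ∀ {n} → Graph n → List (Fin n) → Fin n → Set
InClosedNbhd G D v = Any (λ d → (v ≡ d) ⊎ (d ∼[ G ] v)) D

HasP3Outside : ∀ {n} → Graph n → List (Fin n) → Set
HasP3Outside {n} G D =
  Σ (Fin n) λ a → Σ (Fin n) λ b → Σ (Fin n) λ c →
    ¬ InClosedNbhd G D a × ¬ InClosedNbhd G D b × ¬ InClosedNbhd G D c ×
    a ≢ b × b ≢ c × a ≢ c ×
    a ∼[ G ] b × b ∼[ G ] c

IsP3Isolating : ∀ {n} → Graph n → List (Fin n) → Set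
IsP3Isolating G D = ¬ HasP3Outside G D

-- ι(G,P3) ≤ k : there is a P3-isolating set of size at most k
-- (a list of length ≤ k; duplicates only shrink the underlying set)
IotaP3≤ : ∀ {n} → Graph n → ℕ → Set
IotaP3≤ {n} G k = Σ (List (Fin n)) λ D → length D ≤ k × IsP3Isolating G D

{-# OPTIONS --safe #-}
-- If G − N[D] contains a path a–b–c, then putting its centre b
-- into D dominates a, b and c, so the number of undominated vertices drops by at
-- least 3. Starting from n ≤ 3k + 2 undominated vertices, after at most k such steps
-- fewer than 3 remain, which is too few to carry a P₃.
module Submission where

open import Defs
open import Data.Nat using (ℕ; suc; zero; _+_; _*_; _≤_; _<_; s≤s)
open import Data.Nat.Properties using (≤-trans; m≤m+n; m+n≤o⇒m≤o; +-cancelˡ-≤; +-suc; <⇒≱)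
open import Data.Fin using (Fin; _≟_)
open import Data.Fin.Subset using (Subset; _∈_; _∉_; _⊆_; ⊤; ⁅_⁆; _∪_; _∩_; ∁; _-_; ∣_∣)
open import Data.Fin.Subset.Properties
  using (x∈p⇒∣p-x∣<∣p∣; x∈p∧x≢y⇒x∈p-y; p⊆q⇒∣p∣≤∣q∣; x∈p∩q⁺; x∈p∩q⁻; x∈p∪q⁺; x∈p∪q⁻;
         x∈⁅x⁆; x∈⁅y⁆⇒x≡y; x∉p⇒x∈∁p; x∈∁p⇒x∉p; ∈⊤; ∣⊤∣≡n)
import Data.Fin.Properties as Fin
import Data.Bool.Properties as Bool
open import Data.Vec using (tabulate)
open import Data.Vec.Properties using (lookup∘tabulate; lookup⇒[]=; []=⇒lookup)
open import Data.List using (List; []; _∷_; length)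
open import Data.List.Relation.Unary.Any using (here; there)
import Data.List.Relation.Unary.Any as Any
open import Data.Product using (∃; _,_; proj₁; proj₂)
open import Data.Sum using (_⊎_; inj₁; inj₂)
open import Function using (_∘_)
open import Relation.Binary.PropositionalEquality
  using (_≡_; _≢_; ≢-sym; refl; trans; subst) renaming (sym to ≡-sym)
open import Relation.Nullary using (Dec; yes; no; ¬_; ¬?; contradiction)
open import Relation.Nullary.Decidable using (_×-dec_; _⊎-dec_)

3+∣p-a-b-c∣≤∣p∣ : ∀ {n} {p : Subset n} {a b c} →
                  a ∈ p → b ∈ p → c ∈ p → a ≢ b → a ≢ c → b ≢ c →
                  3 + ∣ p - a - b - c ∣ ≤ ∣ p ∣
3+∣p-a-b-c∣≤∣p∣ {p = p} {a} {b} {c} a∈p b∈p c∈p a≢b a≢c b≢c =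
  ≤-trans (s≤s (s≤s c-drop)) (≤-trans (s≤s b-drop) a-drop)
  where
  a-drop : ∣ p - a ∣ < ∣ p ∣
  a-drop = x∈p⇒∣p-x∣<∣p∣ a∈p
  b-drop : ∣ p - a - b ∣ < ∣ p - a ∣
  b-drop = x∈p⇒∣p-x∣<∣p∣ (x∈p∧x≢y⇒x∈p-y b∈p (≢-sym a≢b))
  c-drop : ∣ p - a - b - c ∣ < ∣ p - a - b ∣
  c-drop = x∈p⇒∣p-x∣<∣p∣ (x∈p∧x≢y⇒x∈p-y (x∈p∧x≢y⇒x∈p-y c∈p (≢-sym a≢c)) (≢-sym b≢c))

p∩∁q⊆p-a-b-c : ∀ {n} {p q : Subset n} {a b c} →
               a ∈ q → b ∈ q → c ∈ q → p ∩ ∁ q ⊆ p - a - b - c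
p∩∁q⊆p-a-b-c {p = p} {q} a∈q b∈q c∈q {x} x∈p∩∁q =
  x∈p∧x≢y⇒x∈p-y (x∈p∧x≢y⇒x∈p-y (x∈p∧x≢y⇒x∈p-y x∈p (x≢ a∈q)) (x≢ b∈q)) (x≢ c∈q)
  where
  x∈p : x ∈ p
  x∈p = proj₁ (x∈p∩q⁻ p (∁ q) x∈p∩∁q)
  x∉q : x ∉ q
  x∉q = x∈∁p⇒x∉p (proj₂ (x∈p∩q⁻ p (∁ q) x∈p∩∁q))
  x≢ : ∀ {y} → y ∈ q → x ≢ y
  x≢ y∈q refl = x∉q y∈q

3+∣p∩∁q∣≤∣p∣ : ∀ {n} {p q : Subset n} {a b c} →
               a ∈ p → b ∈ p → c ∈ p → a ∈ q → b ∈ q → c ∈ q → a ≢ b → a ≢ c → b ≢ c →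
               3 + ∣ p ∩ ∁ q ∣ ≤ ∣ p ∣
3+∣p∩∁q∣≤∣p∣ {p = p} a∈p b∈p c∈p a∈q b∈q c∈q a≢b a≢c b≢c =
  ≤-trans (s≤s (s≤s (s≤s (p⊆q⇒∣p∣≤∣q∣ (p∩∁q⊆p-a-b-c {p = p} a∈q b∈q c∈q)))))
          (3+∣p-a-b-c∣≤∣p∣ a∈p b∈p c∈p a≢b a≢c b≢c)

module _ {n : ℕ} (G : Graph n) where

  N[_] : Fin n → Subset n
  N[ d ] = ⁅ d ⁆ ∪ tabulate (adj G d)

  ∈N[]⁺ : ∀ {d x} → x ≡ d ⊎ d ∼[ G ] x → x ∈ N[ d ]
  ∈N[]⁺ (inj₁ refl) = x∈p∪q⁺ (inj₁ (x∈⁅x⁆ _))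
  ∈N[]⁺ {d} {x} (inj₂ d∼x) =
    x∈p∪q⁺ (inj₂ (lookup⇒[]= x _ (trans (lookup∘tabulate (adj G d) x) d∼x)))

  ∈N[]⁻ : ∀ {d x} → x ∈ N[ d ] → x ≡ d ⊎ d ∼[ G ] x
  ∈N[]⁻ {d} {x} x∈N[d] with x∈p∪q⁻ ⁅ d ⁆ _ x∈N[d]
  ... | inj₁ x∈⁅d⁆ = inj₁ (x∈⁅y⁆⇒x≡y d x∈⁅d⁆)
  ... | inj₂ x∈Nd = inj₂ (trans (≡-sym (lookup∘tabulate (adj G d) x)) ([]=⇒lookup x∈Nd))

  undominated : List (Fin n) → Subset n
  undominated []      = ⊤
  undominated (d ∷ D) = undominated D ∩ ∁ N[ d ]

  ∉N[D]⇒∈undominated : ∀ D {x} → ¬ InClosedNbhd G D x → x ∈ undominated D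
  ∉N[D]⇒∈undominated []      _   = ∈⊤
  ∉N[D]⇒∈undominated (d ∷ D) x∉ =
    x∈p∩q⁺ (∉N[D]⇒∈undominated D (x∉ ∘ there) , x∉p⇒x∈∁p (x∉ ∘ here ∘ ∈N[]⁻))

  centre-dominates-3 : ∀ D → HasP3Outside G D →
                       ∃ λ b → 3 + ∣ undominated (b ∷ D) ∣ ≤ ∣ undominated D ∣
  centre-dominates-3 D (a , b , c , a∉ , b∉ , c∉ , a≢b , b≢c , a≢c , a∼b , b∼c) =
    b , 3+∣p∩∁q∣≤∣p∣ (∉N[D]⇒∈undominated D a∉) (∉N[D]⇒∈undominated D b∉)
                     (∉N[D]⇒∈undominated D c∉)
                     (∈N[]⁺ (inj₂ (trans (Graph.sym G b a) a∼b))) (∈N[]⁺ (inj₁ refl))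
                     (∈N[]⁺ (inj₂ b∼c))
                     a≢b a≢c b≢c

  HasP3Outside? : ∀ D → Dec (HasP3Outside G D)
  HasP3Outside? D = Fin.any? λ a → Fin.any? λ b → Fin.any? λ c →
    ¬? (N[D]? a) ×-dec ¬? (N[D]? b) ×-dec ¬? (N[D]? c) ×-dec
    ¬? (a ≟ b) ×-dec ¬? (b ≟ c) ×-dec ¬? (a ≟ c) ×-dec
    adj G a b Bool.≟ _ ×-dec adj G b c Bool.≟ _
    where
    N[D]? : ∀ v → Dec (InClosedNbhd G D v)
    N[D]? v = Any.any? (λ d → (v ≟ d) ⊎-dec (adj G d v Bool.≟ _)) D

  -- The bound is written suc k * 3 so that suc (suc k) * 3 unfolds to 3 + suc k * 3.
  greedy : ∀ k D → ∣ undominated D ∣ < suc k * 3 → IotaP3≤ G (length D + k)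
  greedy k D few with HasP3Outside? D
  ... | no isolating = D , m≤m+n (length D) k , isolating
  ... | yes P3 with k | centre-dominates-3 D P3
  ...   | zero  | _ , drop = contradiction (m+n≤o⇒m≤o 3 drop) (<⇒≱ few)
  ...   | suc k | b , drop = subst (IotaP3≤ G) (≡-sym (+-suc (length D) k))
                                   (greedy k (b ∷ D) (+-cancelˡ-≤ 3 _ _ (≤-trans (s≤s drop) few)))

n<[1+k]*3⇒IotaP3≤k : ∀ {n} (G : Graph n) k → n < suc k * 3 → IotaP3≤ G k
n<[1+k]*3⇒IotaP3≤k {n} G k n<[1+k]*3 =
  greedy G k [] (subst (_< suc k * 3) (≡-sym (∣⊤∣≡n n)) n<[1+k]*3)

lemma2p11 : (n : ℕ) → n ≤ 8 → (G : Graph n) → IotaP3≤ G 2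
lemma2p11 n n≤8 G = n<[1+k]*3⇒IotaP3≤k G 2 (s≤s n≤8)
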